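{- Let $k\ge 3$ and $s\ge k-1$ be integers. Then every $(k\times (k-1)s,\ ks)$-near triple array is a $(k\times (k-1)s,\ ks)$-near balanced grid, and every $(k\times (k-1)s,\ ks)$-near balanced grid is a $(k\times (k-1)s,\ ks)$-near triple array.
   Context: For real $x$ write $x^-=\lfloor x\rfloor$, $x^+=\lceil x\rceil$. An $r\times c$ row-column design on $v$ symbols is an $r\times c$ array each of whose cells holds one of $v$ symbols; it is binary if no symbol occurs twice in a row or in a column. Let $e=rc/v$; the design is equireplicate if $e$ is an integer and each symbol occurs exactly $e$ times, and near equireplicate if $e$ is not an integer and each symbol occurs $e^-$ or $e^+$ times. For a binary design, with $R_i$, $C_j$ the symbol sets of row $i$ and column $j$, let $\lambda_{rc}$, $\lambda_{rr}$, $\lambda_{cc}$ be the averages of $|R_i\cap C_j|$ over all row–column pairs, of $|R_i\cap R_j|$ over pairs of distinct rows, and of $|C_i\cap C_j|$ over pairs of distinct columns. An $(r\times c,v)$-near triple array is a binary equireplicate or near equireplicate $r\times c$ design on $v$ symbols in which every row and column share $\lambda_{rc}^-$ or $\lambda_{rc}^+$ symbols, every two distinct rows share $\lambda_{rr}^-$ or $\lambda_{rr}^+$ symbols, and every two distinct columns share $\lambda_{cc}^-$ or $\lambda_{cc}^+$ symbols. Let $\mu=\frac{\binom{c}{2}r+\binom{r}{2}c}{\binom{v}{2}}$. An $(r\times c,v)$-near balanced grid is a binary equireplicate or near equireplicate $r\times c$ design on $v$ symbols in which, for each pair of distinct symbols, the number of rows plus the number of columns containing both symbols is $\mu^-$ or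 $\mu^+$. -}

module Defs where

open import Data.Nat using (ℕ; zero; suc; _+_; _*_; _∸_)
open import Data.Nat.DivMod using (_/_)
open import Data.Nat.Combinatorics using (_C_)
open import Data.Fin using (Fin; zero; suc; _≟_)
open import Data.Bool using (Bool; true; false; if_then_else_; _∧_; _∨_)
open import Data.Sum using (_⊎_)
open import Data.Product using (_×_)
open import Relation.Nullary using (¬_)
open import Relation.Nullary.Decidable using (⌊_⌋)
open import Relation.Binary.PropositionalEquality using (_≡_; _≢_)

Design : ℕ → ℕ → ℕ → Set
Design r c v = Fin r → Fin c → Fin v

sumF : ∀ n → (Fin n → ℕ) → ℕ
sumF zero    f = 0
sumF (suc n) f = f zero + sumF n (λ i → f (suc i))

anyF : ∀ n → (Fin n → Bool) → Bool
anyF zero    f = false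
anyF (suc n) f = f zero ∨ anyF n (λ i → f (suc i))

count : ∀ n → (Fin n → Bool) → ℕ
count n p = sumF n (λ i → if p i then 1 else 0)

-- floor and ceiling of the rational p / q (q > 0); for q = 0 both are 0 (never used)
floorDiv : ℕ → ℕ → ℕ
floorDiv p zero    = 0
floorDiv p (suc q) = p / suc q

ceilDiv : ℕ → ℕ → ℕ
ceilDiv p zero    = 0
ceilDiv p (suc q) = (p + q) / suc q

Near : ℕ → ℕ → ℕ → Set
Near n p q = (n ≡ floorDiv p q) ⊎ (n ≡ ceilDiv p q)

module _ {r c v : ℕ} (A : Design r c v) where

  Binary : Set
  Binary = (∀ i j j' → A i j ≡ A i j' → j ≡ j')
         × (∀ i i' j → A i j ≡ A i' j → i ≡ i')

  rep : Fin v → ℕ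
  rep x = sumF r (λ i → count c (λ j → ⌊ A i j ≟ x ⌋))

  -- equireplicate or near equireplicate (e = rc/v): every symbol occurs e^- or e^+ times
  -- (when e is an integer, e^- = e^+ = e, so this is exactly equireplicate)
  EquiOrNearEqui : Set
  EquiOrNearEqui = ∀ x → Near (rep x) (r * c) v

  inRow : Fin r → Fin v → Bool
  inRow i x = anyF c (λ j → ⌊ A i j ≟ x ⌋)

  inCol : Fin c → Fin v → Bool
  inCol j x = anyF r (λ i → ⌊ A i j ≟ x ⌋)

  rcMeet : Fin r → Fin c → ℕ
  rcMeet i j = count v (λ x → inRow i x ∧ inCol j x)

  rrMeet : Fin r → Fin r → ℕ
  rrMeet i i' = count v (λ x → inRow i x ∧ inRow i' x)

  ccMeet : Fin c → Fin c → ℕ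
  ccMeet j j' = count v (λ x → inCol j x ∧ inCol j' x)

  -- totals; the averages are  totRC / (r*c),  totRR / (r*(r-1)),  totCC / (c*(c-1))
  -- (sums over ordered pairs of distinct rows/columns; same average as unordered pairs)
  totRC : ℕ
  totRC = sumF r (λ i → sumF c (λ j → rcMeet i j))

  totRR : ℕ
  totRR = sumF r (λ i → sumF r (λ i' → if ⌊ i ≟ i' ⌋ then 0 else rrMeet i i'))

  totCC : ℕ
  totCC = sumF c (λ j → sumF c (λ j' → if ⌊ j ≟ j' ⌋ then 0 else ccMeet j j'))

  NearTripleArray : Set
  NearTripleArray =
    Binary × EquiOrNearEqui
    × (∀ i j → Near (rcMeet i j) totRC (r * c))
    × (∀ i i' → i ≢ i' → Near (rrMeet i i') totRR (r * (r ∸ 1)))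
    × (∀ j j' → j ≢ j' → Near (ccMeet j j') totCC (c * (c ∸ 1)))

  pairCount : Fin v → Fin v → ℕ
  pairCount x y = count r (λ i → inRow i x ∧ inRow i y)
                + count c (λ j → inCol j x ∧ inCol j y)

  NearBalancedGrid : Set
  NearBalancedGrid =
    Binary × EquiOrNearEqui
    × (∀ x y → x ≢ y → Near (pairCount x y) ((c C 2) * r + (r C 2) * c) (v C 2))

{-# OPTIONS --safe #-}
-- Every symbol occurs d = k − 1 times, so in a binary design it is missing from exactly one
-- row. Hence two rows always share 2c − v symbols, and two symbols share d rows if they miss
-- the same row and d − 1 rows otherwise. Double counting gives λ_rc = d,
-- λ_cc = (d − 1)k/(c − 1) ∈ (0, 1] and d − 1 < μ ≤ d, where λ_cc = 1 and μ = d exactly when s = d.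
-- Both notions therefore reduce to the same two properties of the design:
--   (a) two symbols missing the same row never share a column, and
--   (b) two symbols share at most one column.
-- Since a column holds d + 1 symbols, |R_i ∩ C_j| = d says that exactly one of them misses
-- row i, so (a) is equivalent to λ_rc being attained everywhere; (b) is equivalent to
-- |C_j ∩ C_j'| ≤ 1 by exchanging the roles of symbols and columns; and (a) with (b) says
-- exactly that every pair count is at most d. When s = d, the remaining equalities
-- |C_j ∩ C_j'| = 1 and pair count = d hold because quantities bounded by 1 already sum to
-- their maximum.
module Submission where

open import Defs
open import Data.Nat using (ℕ; zero; suc; _+_; _*_; _∸_; _≤_; _<_; z≤n; s≤s; z<s)
open import Data.Nat.Properties
  using ( ≤-refl; ≤-trans; ≤-antisym; ≤-reflexive; ≤-pred; <⇒≤; <⇒≱; n≤0⇒n≡0; n≤1+n; n<1+n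
        ; m≤m+n; m≤n+m; m<m+n; m≤n*m; m≤n⇒m<n∨m≡n; m≤n⇒∃[o]m+o≡n; m+n∸n≡m
        ; +-comm; +-assoc; +-suc; +-identityʳ; +-mono-≤; +-monoʳ-≤; +-monoˡ-≤; +-monoʳ-<
        ; +-cancelˡ-≡; +-cancelʳ-≡; +-cancelˡ-≤; +-cancelʳ-≤
        ; *-comm; *-assoc; *-suc; *-zeroʳ; *-identityˡ; *-identityʳ; *-distribˡ-+
        ; *-monoʳ-≤; *-monoʳ-<; *-cancelˡ-≤; *-cancelˡ-<; *-cancelˡ-≡
        ; module ≤-Reasoning )
open import Data.Nat.DivMod using (_/_; m*n/n≡m; /-monoˡ-≤; m<n*o⇒m/o<n)
open import Data.Nat.Combinatorics using (_C_; nCk+nC[k+1]≡[n+1]C[k+1]; nC1≡n)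
open import Data.Fin using (Fin; zero; suc; _≟_)
open import Data.Fin.Properties using (suc-injective; any?)
open import Data.Bool using (Bool; true; false; if_then_else_; _∧_; _∨_; not)
open import Data.Bool.Properties using (∧-comm; ∧-idem; ∧-identityʳ; ∧-zeroʳ; ¬-not; not-injective)
import Data.Bool as Bool
open import Data.Product using (_×_; _,_; ∃; proj₁; proj₂)
open import Data.Sum using (inj₁; inj₂; [_,_]′)
open import Data.Empty using (⊥; ⊥-elim)
open import Relation.Nullary using (yes; no; contradiction)
open import Relation.Nullary.Decidable using (⌊_⌋; decidable-stable; toSum; ⌊⌋-map′; isYes≗does; dec-true; dec-false)
open import Relation.Binary.PropositionalEquality
open import Data.Nat.Tactic.RingSolver using (solve-∀)

-- Finite sums and counting

sumF-cong : ∀ n {f g : Fin n → ℕ} → (∀ i → f i ≡ g i) → sumF n f ≡ sumF n g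
sumF-cong zero    f≗g = refl
sumF-cong (suc n) f≗g = cong₂ _+_ (f≗g zero) (sumF-cong n (λ i → f≗g (suc i)))

sumF-+ : ∀ n (f g : Fin n → ℕ) → sumF n (λ i → f i + g i) ≡ sumF n f + sumF n g
sumF-+ zero    f g = refl
sumF-+ (suc n) f g = begin
  f zero + g zero + sumF n (λ i → f (suc i) + g (suc i))                  ≡⟨ cong (f zero + g zero +_) (sumF-+ n (λ i → f (suc i)) (λ i → g (suc i))) ⟩
  f zero + g zero + (sumF n (λ i → f (suc i)) + sumF n (λ i → g (suc i))) ≡⟨ interchange (f zero) (g zero) _ _ ⟩
  f zero + sumF n (λ i → f (suc i)) + (g zero + sumF n (λ i → g (suc i))) ∎
  where
  open ≡-Reasoning
  interchange : ∀ a b c d → a + b + (c + d) ≡ a + c + (b + d)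
  interchange = solve-∀

sumF-const : ∀ n m → sumF n (λ _ → m) ≡ n * m
sumF-const zero    m = refl
sumF-const (suc n) m = cong (m +_) (sumF-const n m)

sumF-*ˡ : ∀ n m (f : Fin n → ℕ) → sumF n (λ i → m * f i) ≡ m * sumF n f
sumF-*ˡ zero    m f = sym (*-zeroʳ m)
sumF-*ˡ (suc n) m f = trans (cong (m * f zero +_) (sumF-*ˡ n m (λ i → f (suc i))))
                            (sym (*-distribˡ-+ m (f zero) _))

sumF-swap : ∀ n m (h : Fin n → Fin m → ℕ) →
            sumF n (λ i → sumF m (h i)) ≡ sumF m (λ j → sumF n (λ i → h i j))
sumF-swap zero    m h = sym (trans (sumF-const m 0) (*-zeroʳ m))
sumF-swap (suc n) m h = trans (cong (sumF m (h zero) +_) (sumF-swap n m (λ i → h (suc i))))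
                              (sym (sumF-+ m (h zero) (λ j → sumF n (λ i → h (suc i) j))))

sumF-mono-≤ : ∀ n {f g : Fin n → ℕ} → (∀ i → f i ≤ g i) → sumF n f ≤ sumF n g
sumF-mono-≤ zero    f≤g = z≤n
sumF-mono-≤ (suc n) f≤g = +-mono-≤ (f≤g zero) (sumF-mono-≤ n (λ i → f≤g (suc i)))

+-mono-≤-≡⇒≡ : ∀ {a b c d} → a ≤ b → c ≤ d → a + c ≡ b + d → a ≡ b × c ≡ d
+-mono-≤-≡⇒≡ {a} {b} {c} {d} a≤b c≤d eq = a≡b , +-cancelˡ-≡ a c d (trans eq (cong (_+ d) (sym a≡b)))
  where
  a≡b : a ≡ b
  a≡b = ≤-antisym a≤b (+-cancelʳ-≤ c b a (≤-trans (+-monoʳ-≤ b c≤d) (≤-reflexive (sym eq))))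

sumF-mono-≤-≡⇒≡ : ∀ n {f g : Fin n → ℕ} → (∀ i → f i ≤ g i) → sumF n f ≡ sumF n g → ∀ i → f i ≡ g i
sumF-mono-≤-≡⇒≡ (suc n) f≤g eq zero    = proj₁ (+-mono-≤-≡⇒≡ (f≤g zero) (sumF-mono-≤ n (λ i → f≤g (suc i))) eq)
sumF-mono-≤-≡⇒≡ (suc n) f≤g eq (suc i) =
  sumF-mono-≤-≡⇒≡ n (λ i → f≤g (suc i)) (proj₂ (+-mono-≤-≡⇒≡ (f≤g zero) (sumF-mono-≤ n (λ i → f≤g (suc i))) eq)) i

≤-sumF : ∀ n (f : Fin n → ℕ) i → f i ≤ sumF n f
≤-sumF (suc n) f zero    = m≤m+n (f zero) _
≤-sumF (suc n) f (suc i) = ≤-trans (≤-sumF n (λ j → f (suc j)) i) (m≤n+m _ (f zero))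

+-≤-sumF : ∀ n (f : Fin n → ℕ) {i j} → i ≢ j → f i + f j ≤ sumF n f
+-≤-sumF (suc n) f {zero}  {zero}  i≢j = contradiction refl i≢j
+-≤-sumF (suc n) f {zero}  {suc j} i≢j = +-monoʳ-≤ (f zero) (≤-sumF n (λ k → f (suc k)) j)
+-≤-sumF (suc n) f {suc i} {zero}  i≢j =
  ≤-trans (≤-reflexive (+-comm (f (suc i)) (f zero))) (+-monoʳ-≤ (f zero) (≤-sumF n (λ k → f (suc k)) i))
+-≤-sumF (suc n) f {suc i} {suc j} i≢j =
  ≤-trans (+-≤-sumF n (λ k → f (suc k)) (λ i≡j → i≢j (cong suc i≡j))) (m≤n+m _ (f zero))

⌊≟⌋-refl : ∀ {n} (i : Fin n) → ⌊ i ≟ i ⌋ ≡ true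
⌊≟⌋-refl i = trans (isYes≗does (i ≟ i)) (dec-true (i ≟ i) refl)

⌊≟⌋-≢ : ∀ {n} {i j : Fin n} → i ≢ j → ⌊ i ≟ j ⌋ ≡ false
⌊≟⌋-≢ {i = i} {j} i≢j = trans (isYes≗does (i ≟ j)) (dec-false (i ≟ j) i≢j)

⌊≟⌋≡true⇒≡ : ∀ {n} {i j : Fin n} → ⌊ i ≟ j ⌋ ≡ true → i ≡ j
⌊≟⌋≡true⇒≡ {i = i} {j} eq with i ≟ j
... | yes i≡j = i≡j

-- The summands of totRR and totCC in Defs are literally of this form.
punctured : ∀ {n} → Fin n → (Fin n → ℕ) → Fin n → ℕ
punctured i f j = if ⌊ i ≟ j ⌋ then 0 else f j

punctured-≢ : ∀ {n} {i j : Fin n} (f : Fin n → ℕ) → i ≢ j → punctured i f j ≡ f j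
punctured-≢ f i≢j = cong (if_then 0 else f _) (⌊≟⌋-≢ i≢j)

sumF-punctured : ∀ n (i : Fin n) (f : Fin n → ℕ) → sumF n (punctured i f) + f i ≡ sumF n f
sumF-punctured (suc n) zero    f = +-comm _ (f zero)
sumF-punctured (suc n) (suc i) f = begin
  f zero + sumF n (λ j → punctured (suc i) f (suc j)) + f (suc i)   ≡⟨ +-assoc (f zero) _ _ ⟩
  f zero + (sumF n (λ j → punctured (suc i) f (suc j)) + f (suc i)) ≡⟨ cong (λ x → f zero + (x + f (suc i))) (sumF-cong n shift) ⟩
  f zero + (sumF n (punctured i (λ j → f (suc j))) + f (suc i))     ≡⟨ cong (f zero +_) (sumF-punctured n i (λ j → f (suc j))) ⟩
  f zero + sumF n (λ j → f (suc j))                                  ∎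
  where
  open ≡-Reasoning
  shift : ∀ j → punctured (suc i) f (suc j) ≡ punctured i (λ j → f (suc j)) j
  shift j = cong (if_then 0 else f (suc j)) (⌊⌋-map′ (cong suc) suc-injective (i ≟ j))

sumF-punctured-const : ∀ n (i : Fin (suc n)) m → sumF (suc n) (punctured i (λ _ → m)) ≡ n * m
sumF-punctured-const n i m = +-cancelʳ-≡ m _ _ (trans (sumF-punctured (suc n) i (λ _ → m)) (trans (sumF-const (suc n) m) (+-comm m (n * m))))

punctured-cong : ∀ {n} (i : Fin n) {f g : Fin n → ℕ} → (∀ j → i ≢ j → f j ≡ g j) → ∀ j → punctured i f j ≡ punctured i g j
punctured-cong i f≗g j with i ≟ j
... | yes _   = refl
... | no  i≢j = f≗g j i≢j

punctured-mono-≤ : ∀ {n} (i : Fin n) {f g : Fin n → ℕ} → (∀ j → i ≢ j → f j ≤ g j) → ∀ j → punctured i f j ≤ punctured i g j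
punctured-mono-≤ i f≤g j with i ≟ j
... | yes _   = z≤n
... | no  i≢j = f≤g j i≢j

ind : Bool → ℕ
ind b = if b then 1 else 0

count-cong : ∀ n {p q : Fin n → Bool} → (∀ i → p i ≡ q i) → count n p ≡ count n q
count-cong n p≗q = sumF-cong n (λ i → cong ind (p≗q i))

count-false : ∀ n {p : Fin n → Bool} → (∀ i → p i ≡ false) → count n p ≡ 0
count-false n p≗false = trans (count-cong n p≗false) (trans (sumF-const n 0) (*-zeroʳ n))

count-true : ∀ n {p : Fin n → Bool} → (∀ i → p i ≡ true) → count n p ≡ n
count-true n p≗true = trans (count-cong n p≗true) (trans (sumF-const n 1) (*-identityʳ n))

count≥1 : ∀ n (p : Fin n → Bool) {i} → p i ≡ true → 1 ≤ count n p
count≥1 n p {i} pᵢ = subst (λ b → ind b ≤ count n p) pᵢ (≤-sumF n (λ j → ind (p j)) i)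

count≥2 : ∀ n (p : Fin n → Bool) {i j} → i ≢ j → p i ≡ true → p j ≡ true → 2 ≤ count n p
count≥2 n p i≢j pᵢ pⱼ = subst₂ (λ a b → ind a + ind b ≤ count n p) pᵢ pⱼ (+-≤-sumF n (λ k → ind (p k)) i≢j)

AtMostOne : ∀ n → (Fin n → Bool) → Set
AtMostOne n p = ∀ i j → p i ≡ true → p j ≡ true → i ≡ j

AtMostOne-suc : ∀ n {p : Fin (suc n) → Bool} → AtMostOne (suc n) p → AtMostOne n (λ i → p (suc i))
AtMostOne-suc n unique i j pᵢ pⱼ = suc-injective (unique (suc i) (suc j) pᵢ pⱼ)

AtMostOne⇒false : ∀ {n p i j} → AtMostOne n p → p i ≡ true → i ≢ j → p j ≡ false
AtMostOne⇒false {p = p} {j = j} unique pᵢ i≢j with p j in pⱼ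
... | false = refl
... | true  = contradiction (unique _ _ pᵢ pⱼ) i≢j

count≤1 : ∀ n (p : Fin n → Bool) → AtMostOne n p → count n p ≤ 1
count≤1 zero    p unique = z≤n
count≤1 (suc n) p unique with p zero in p₀
... | true  = ≤-reflexive (cong suc (count-false n (λ i → AtMostOne⇒false unique p₀ λ ())))
... | false = count≤1 n (λ i → p (suc i)) (AtMostOne-suc n unique)

ind-anyF : ∀ n (p : Fin n → Bool) → AtMostOne n p → ind (anyF n p) ≡ count n p
ind-anyF zero    p unique = refl
ind-anyF (suc n) p unique with p zero in p₀
... | true  = cong suc (sym (count-false n (λ i → AtMostOne⇒false unique p₀ λ ())))
... | false = ind-anyF n (λ i → p (suc i)) (AtMostOne-suc n unique)

count≡1⇒∃! : ∀ n (p : Fin n → Bool) → count n p ≡ 1 → ∃ λ i → p i ≡ true × (∀ j → p j ≡ true → j ≡ i)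
count≡1⇒∃! n p count≡1 with any? (λ i → p i Bool.≟ true)
... | yes (i , pᵢ) = i , pᵢ , unique
  where
  unique : ∀ j → p j ≡ true → j ≡ i
  unique j pⱼ with j ≟ i
  ... | yes j≡i = j≡i
  ... | no  j≢i = contradiction (subst (2 ≤_) count≡1 (count≥2 n p j≢i pⱼ pᵢ)) λ { (s≤s ()) }
... | no ¬∃ = contradiction (trans (sym count≡1) (count-false n (λ i → ¬-not (λ pᵢ → ¬∃ (i , pᵢ))))) λ ()

count-≟ : ∀ n (a : Fin n) → count n (λ x → ⌊ a ≟ x ⌋) ≡ 1
count-≟ n a = ≤-antisym (count≤1 n _ λ i j aᵢ aⱼ → trans (sym (⌊≟⌋≡true⇒≡ aᵢ)) (⌊≟⌋≡true⇒≡ aⱼ))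
                        (count≥1 n _ (⌊≟⌋-refl a))

count-not : ∀ n (p : Fin n → Bool) → count n p + count n (λ i → not (p i)) ≡ n
count-not n p = trans (sym (sumF-+ n _ _)) (trans (sumF-cong n (λ i → ind-not (p i))) (trans (sumF-const n 1) (*-identityʳ n)))
  where
  ind-not : ∀ b → ind b + ind (not b) ≡ 1
  ind-not true  = refl
  ind-not false = refl

count-split : ∀ n (p q : Fin n → Bool) → count n p ≡ count n (λ i → p i ∧ q i) + count n (λ i → p i ∧ not (q i))
count-split n p q = trans (sumF-cong n (λ i → ind-split (p i) (q i))) (sumF-+ n _ _)
  where
  ind-split : ∀ a b → ind a ≡ ind (a ∧ b) + ind (a ∧ not b)
  ind-split true  true  = refl
  ind-split true  false = refl
  ind-split false b     = refl

count-∧-cover : ∀ n (p q : Fin n → Bool) → (∀ i → p i ∨ q i ≡ true) →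
                count n (λ i → p i ∧ q i) + n ≡ count n p + count n q
count-∧-cover n p q cover = begin
  count n (λ i → p i ∧ q i) + n                          ≡⟨ cong (count n (λ i → p i ∧ q i) +_) (sym (count-true n cover)) ⟩
  count n (λ i → p i ∧ q i) + count n (λ i → p i ∨ q i) ≡⟨ sym (sumF-+ n _ _) ⟩
  sumF n (λ i → ind (p i ∧ q i) + ind (p i ∨ q i))       ≡⟨ sumF-cong n (λ i → inclusion-exclusion (p i) (q i)) ⟩
  sumF n (λ i → ind (p i) + ind (q i))                   ≡⟨ sumF-+ n _ _ ⟩
  count n p + count n q                                  ∎
  where
  open ≡-Reasoning
  inclusion-exclusion : ∀ a b → ind (a ∧ b) + ind (a ∨ b) ≡ ind a + ind b
  inclusion-exclusion true  true  = refl
  inclusion-exclusion true  false = refl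
  inclusion-exclusion false true  = refl
  inclusion-exclusion false false = refl

∧≡true⇒× : ∀ {a b : Bool} → a ∧ b ≡ true → a ≡ true × b ≡ true
∧≡true⇒× {true} {true} _ = refl , refl

∧-≡ˡ : ∀ {a b : Bool} → (a ≡ true → b ≡ true) → a ∧ b ≡ a
∧-≡ˡ {true}  a⇒b = a⇒b refl
∧-≡ˡ {false} a⇒b = refl

∧-≡false : ∀ {a b : Bool} → (a ≡ true → b ≡ true → ⊥) → a ∧ b ≡ false
∧-≡false {true}  {true}  ¬a∧b = ⊥-elim (¬a∧b refl refl)
∧-≡false {true}  {false} ¬a∧b = refl
∧-≡false {false}         ¬a∧b = refl

≤-ind : ∀ {n} {b : Bool} → (b ≡ true → n ≤ 1) → (b ≡ false → n ≤ 0) → n ≤ ind b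
≤-ind {b = true}  ≤1 ≤0 = ≤1 refl
≤-ind {b = false} ≤1 ≤0 = ≤0 refl

∨-≡true : ∀ {a b : Bool} → (a ≡ false → b ≡ true) → a ∨ b ≡ true
∨-≡true {true}  ¬a⇒b = refl
∨-≡true {false} ¬a⇒b = ¬a⇒b refl

-- Double counting in incidence structures

double-counting : ∀ n m (Q : Fin n → Fin m → Bool) (P : Fin m → Bool) e →
                  (∀ b → P b ≡ true → count n (λ a → Q a b) ≡ e) →
                  sumF n (λ a → count m (λ b → Q a b ∧ P b)) ≡ e * count m P
double-counting n m Q P e regular = begin
  sumF n (λ a → count m (λ b → Q a b ∧ P b)) ≡⟨ sumF-swap n m _ ⟩
  sumF m (λ b → count n (λ a → Q a b ∧ P b)) ≡⟨ sumF-cong m column ⟩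
  sumF m (λ b → e * ind (P b))                ≡⟨ sumF-*ˡ m e _ ⟩
  e * count m P                               ∎
  where
  open ≡-Reasoning
  column : ∀ b → count n (λ a → Q a b ∧ P b) ≡ e * ind (P b)
  column b with P b in Pb
  ... | true  = trans (count-cong n (λ a → ∧-identityʳ (Q a b))) (trans (regular b Pb) (sym (*-identityʳ e)))
  ... | false = trans (count-false n (λ a → ∧-zeroʳ (Q a b))) (sym (*-zeroʳ e))

sumF-punctured-meet : ∀ n m (B : Fin n → Fin m → Bool) (a : Fin n) e →
                      (∀ b → B a b ≡ true → count n (λ a' → B a' b) ≡ e) →
                      sumF n (punctured a (λ a' → count m (λ b → B a b ∧ B a' b))) + count m (B a) ≡ e * count m (B a)
sumF-punctured-meet n m B a e regular = begin
  sumF n (punctured a meet) + count m (B a)             ≡⟨ cong (sumF n (punctured a meet) +_) (count-cong m (λ b → sym (∧-idem (B a b)))) ⟩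
  sumF n (punctured a meet) + meet a                    ≡⟨ sumF-punctured n a meet ⟩
  sumF n meet                                           ≡⟨ sumF-cong n (λ a' → count-cong m (λ b → ∧-comm (B a b) (B a' b))) ⟩
  sumF n (λ a' → count m (λ b → B a' b ∧ B a b))        ≡⟨ double-counting n m B (B a) e regular ⟩
  e * count m (B a)                                     ∎
  where
  open ≡-Reasoning
  meet : Fin n → ℕ
  meet a' = count m (λ b → B a b ∧ B a' b)

meet≤1-transpose : ∀ n m (B : Fin n → Fin m → Bool) →
                   (∀ a a' → a ≢ a' → count m (λ b → B a b ∧ B a' b) ≤ 1) →
                   ∀ b b' → b ≢ b' → count n (λ a → B a b ∧ B a b') ≤ 1
meet≤1-transpose n m B meet≤1 b b' b≢b' = count≤1 n _ unique
  where
  unique : AtMostOne n (λ a → B a b ∧ B a b')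
  unique a a' e e' with a ≟ a'
  ... | yes a≡a' = a≡a'
  ... | no  a≢a' with ∧≡true⇒× {B a b} e | ∧≡true⇒× {B a' b} e'
  ... | ab , ab' | a'b , a'b' =
    contradiction (meet≤1 a a' a≢a') (<⇒≱ (count≥2 m _ b≢b' (cong₂ _∧_ ab a'b) (cong₂ _∧_ ab' a'b')))

-- Floors and ceilings of quotients

floorDiv-unique : ∀ {p q m} → m * q ≤ p → p < suc m * q → floorDiv p q ≡ m
floorDiv-unique {p} {zero}  {m} _  p<0 = contradiction (subst (p <_) (*-zeroʳ (suc m)) p<0) λ ()
floorDiv-unique {p} {suc q} {m} lo hi =
  ≤-antisym (≤-pred (m<n*o⇒m/o<n hi)) (subst (_≤ p / suc q) (m*n/n≡m m (suc q)) (/-monoˡ-≤ (suc q) lo))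

ceilDiv-unique : ∀ {p q m} → m * q < p → p ≤ suc m * q → ceilDiv p q ≡ suc m
ceilDiv-unique {p} {zero}  {m} lo hi = contradiction (≤-trans lo (subst (p ≤_) (*-zeroʳ (suc m)) hi)) λ ()
ceilDiv-unique {p} {suc q} {m} lo hi = floorDiv-unique lo′ hi′
  where
  open ≤-Reasoning
  lo′ : suc m * suc q ≤ p + q
  lo′ = begin
    suc q + m * suc q   ≡⟨ +-comm (suc q) _ ⟩
    m * suc q + suc q   ≡⟨ +-suc (m * suc q) q ⟩
    suc (m * suc q) + q ≤⟨ +-monoˡ-≤ q lo ⟩
    p + q               ∎
  hi′ : p + q < suc (suc m) * suc q
  hi′ = begin-strict
    p + q                   <⟨ s≤s (+-monoˡ-≤ q hi) ⟩
    suc (suc m * suc q + q) ≡⟨ sym (+-suc _ q) ⟩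
    suc m * suc q + suc q   ≡⟨ +-comm _ (suc q) ⟩
    suc q + suc m * suc q   ∎

floorDiv-exact : ∀ m {q} → 0 < q → floorDiv (m * q) q ≡ m
floorDiv-exact m {q} 0<q = floorDiv-unique ≤-refl (subst (m * q <_) (+-comm (m * q) q) (m<m+n (m * q) 0<q))

ceilDiv-exact : ∀ m {q} → 0 < q → ceilDiv (m * q) q ≡ m
ceilDiv-exact m {suc q} _ = floorDiv-unique (m≤m+n (m * suc q) q)
  (subst (m * suc q + q <_) (+-comm (m * suc q) (suc q)) (+-monoʳ-< (m * suc q) (n<1+n q)))

floorDiv≤ceilDiv : ∀ p q → floorDiv p q ≤ ceilDiv p q
floorDiv≤ceilDiv p zero    = z≤n
floorDiv≤ceilDiv p (suc q) = /-monoˡ-≤ (suc q) (m≤m+n p q)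

Near⇒≤ceilDiv : ∀ {n p q} → Near n p q → n ≤ ceilDiv p q
Near⇒≤ceilDiv {p = p} {q} (inj₁ refl) = floorDiv≤ceilDiv p q
Near⇒≤ceilDiv             (inj₂ refl) = ≤-refl

Near-exact⇒ : ∀ {n p q m} → 0 < q → p ≡ m * q → Near n p q → n ≡ m
Near-exact⇒ {m = m} 0<q refl (inj₁ refl) = floorDiv-exact m 0<q
Near-exact⇒ {m = m} 0<q refl (inj₂ refl) = ceilDiv-exact m 0<q

Near-exact⇐ : ∀ {n p q m} → 0 < q → p ≡ m * q → n ≡ m → Near n p q
Near-exact⇐ {m = m} 0<q refl n≡m = inj₁ (trans n≡m (sym (floorDiv-exact m 0<q)))

Near-between : ∀ {n p q m} → floorDiv p q ≡ m → ceilDiv p q ≡ suc m → m ≤ n → n ≤ suc m → Near n p q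
Near-between floor≡m ceil≡1+m m≤n n≤1+m with m≤n⇒m<n∨m≡n m≤n
... | inj₁ m<n = inj₂ (trans (≤-antisym n≤1+m m<n) (sym ceil≡1+m))
... | inj₂ m≡n = inj₁ (trans (sym m≡n) (sym floor≡m))

m*[2*n]≡2*[m*n] : ∀ m n → m * (2 * n) ≡ 2 * (m * n)
m*[2*n]≡2*[m*n] = solve-∀

2*nC2≡n*[n∸1] : ∀ n → 2 * (n C 2) ≡ n * (n ∸ 1)
2*nC2≡n*[n∸1] zero    = refl
2*nC2≡n*[n∸1] (suc n) = begin
  2 * (suc n C 2)           ≡⟨ cong (2 *_) (sym (nCk+nC[k+1]≡[n+1]C[k+1] n 1)) ⟩
  2 * (n C 1 + n C 2)       ≡⟨ *-distribˡ-+ 2 (n C 1) (n C 2) ⟩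
  2 * (n C 1) + 2 * (n C 2) ≡⟨ cong₂ (λ a b → 2 * a + b) (nC1≡n n) (2*nC2≡n*[n∸1] n) ⟩
  2 * n + n * (n ∸ 1)       ≡⟨ step n ⟩
  suc n * n                 ∎
  where
  open ≡-Reasoning
  step : ∀ n → 2 * n + n * (n ∸ 1) ≡ suc n * n
  step zero    = refl
  step (suc n) = poly n
    where
    poly : ∀ n → 2 * suc n + suc n * n ≡ suc (suc n) * suc n
    poly = solve-∀

-- Binary designs

transpose : ∀ {r c v} → Design r c v → Design c r v
transpose A j i = A i j

Binary-transpose : ∀ {r c v} {A : Design r c v} → Binary A → Binary (transpose A)
Binary-transpose (rowInjective , colInjective) = (λ j i i' → colInjective i i' j) , (λ j j' i → rowInjective i j j')

rep-transpose : ∀ {r c v} (A : Design r c v) x → rep (transpose A) x ≡ rep A x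
rep-transpose {r} {c} A x = sumF-swap c r _

module _ {r c v} (A : Design r c v) (bin : Binary A) where

  occurrence-unique : ∀ i x → AtMostOne c (λ j → ⌊ A i j ≟ x ⌋)
  occurrence-unique i x j j' e e' = proj₁ bin i j j' (trans (⌊≟⌋≡true⇒≡ e) (sym (⌊≟⌋≡true⇒≡ e')))

  count-inRow : ∀ x → count r (λ i → inRow A i x) ≡ rep A x
  count-inRow x = sumF-cong r (λ i → ind-anyF c _ (occurrence-unique i x))

  rowSize : ∀ i → count v (inRow A i) ≡ c
  rowSize i = begin
    count v (inRow A i)                          ≡⟨ sumF-cong v (λ x → ind-anyF c _ (occurrence-unique i x)) ⟩
    sumF v (λ x → count c (λ j → ⌊ A i j ≟ x ⌋)) ≡⟨ sumF-swap v c _ ⟩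
    sumF c (λ j → count v (λ x → ⌊ A i j ≟ x ⌋)) ≡⟨ sumF-cong c (λ j → count-≟ v (A i j)) ⟩
    sumF c (λ _ → 1)                             ≡⟨ trans (sumF-const c 1) (*-identityʳ c) ⟩
    c                                            ∎
    where open ≡-Reasoning

module _ {r c v} (A : Design r c v) (bin : Binary A) where

  count-inCol : ∀ x → count c (λ j → inCol A j x) ≡ rep A x
  count-inCol x = trans (count-inRow (transpose A) (Binary-transpose bin) x) (rep-transpose A x)

  colSize : ∀ j → count v (inCol A j) ≡ r
  colSize = rowSize (transpose A) (Binary-transpose bin)

module OneMissingRow {d c v} (A : Design (suc d) c v) (bin : Binary A) (rep≡d : ∀ x → rep A x ≡ d) where

  count-inRow≡d : ∀ x → count (suc d) (λ i → inRow A i x) ≡ d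
  count-inRow≡d x = trans (count-inRow A bin x) (rep≡d x)

  count-inCol≡d : ∀ x → count c (λ j → inCol A j x) ≡ d
  count-inCol≡d x = trans (count-inCol A bin x) (rep≡d x)

  missingRow : ∀ x → ∃ λ i → not (inRow A i x) ≡ true × (∀ i' → not (inRow A i' x) ≡ true → i' ≡ i)
  missingRow x = count≡1⇒∃! (suc d) absent (+-cancelˡ-≡ d _ 1 (begin
    d + count (suc d) absent                                  ≡⟨ cong (_+ count (suc d) absent) (sym (count-inRow≡d x)) ⟩
    count (suc d) (λ i → inRow A i x) + count (suc d) absent ≡⟨ count-not (suc d) (λ i → inRow A i x) ⟩
    suc d                                                     ≡⟨ +-comm 1 d ⟩
    d + 1                                                     ∎))
    where
    open ≡-Reasoning
    absent : Fin (suc d) → Bool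
    absent i = not (inRow A i x)

  miss : Fin v → Fin (suc d)
  miss x = proj₁ (missingRow x)

  inRow-miss : ∀ x → inRow A (miss x) x ≡ false
  inRow-miss x = not-injective (proj₁ (proj₂ (missingRow x)))

  inRow≡false⇒miss : ∀ {i x} → inRow A i x ≡ false → i ≡ miss x
  inRow≡false⇒miss {i} {x} i∌x = proj₂ (proj₂ (missingRow x)) i (cong not i∌x)

  inRow-≢miss : ∀ {i x} → i ≢ miss x → inRow A i x ≡ true
  inRow-≢miss i≢miss = ¬-not (λ i∌x → i≢miss (inRow≡false⇒miss i∌x))

  inRow≡true⇒≢miss : ∀ {i x} → inRow A i x ≡ true → i ≢ miss x
  inRow≡true⇒≢miss {i} {x} i∋x i≡miss = contradiction (trans (sym i∋x) (trans (cong (λ i → inRow A i x) i≡miss) (inRow-miss x))) λ ()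

  rrMeet≡c+c∸v : ∀ {i i'} → i ≢ i' → rrMeet A i i' ≡ c + c ∸ v
  rrMeet≡c+c∸v {i} {i'} i≢i' = trans (sym (m+n∸n≡m _ v))
    (cong (_∸ v) (trans (count-∧-cover v (inRow A i) (inRow A i') cover) (cong₂ _+_ (rowSize A bin i) (rowSize A bin i'))))
    where
    cover : ∀ x → inRow A i x ∨ inRow A i' x ≡ true
    cover x = ∨-≡true (λ i∌x → inRow-≢miss (λ i'≡miss → i≢i' (trans (inRow≡false⇒miss i∌x) (sym i'≡miss))))

  totRR≡ : totRR A ≡ (c + c ∸ v) * (suc d * d)
  totRR≡ = begin
    sumF (suc d) (λ i → sumF (suc d) (punctured i (rrMeet A i)))      ≡⟨ sumF-cong (suc d) (λ i → sumF-cong (suc d) (punctured-cong i (λ i' → rrMeet≡c+c∸v))) ⟩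
    sumF (suc d) (λ i → sumF (suc d) (punctured i (λ _ → c + c ∸ v))) ≡⟨ sumF-cong (suc d) (λ i → sumF-punctured-const d i (c + c ∸ v)) ⟩
    sumF (suc d) (λ _ → d * (c + c ∸ v))                              ≡⟨ sumF-const (suc d) _ ⟩
    suc d * (d * (c + c ∸ v))                                         ≡⟨ rearrange (suc d) d (c + c ∸ v) ⟩
    (c + c ∸ v) * (suc d * d)                                         ∎
    where
    open ≡-Reasoning
    rearrange : ∀ a b c → a * (b * c) ≡ c * (a * b)
    rearrange = solve-∀

  rowPart colPart : Fin v → Fin v → ℕ
  rowPart x y = count (suc d) (λ i → inRow A i x ∧ inRow A i y)
  colPart x y = count c (λ j → inCol A j x ∧ inCol A j y)

  rowPart-sameMiss : ∀ {x y} → miss x ≡ miss y → rowPart x y ≡ d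
  rowPart-sameMiss {x} {y} same = trans (count-cong (suc d) y-follows-x) (count-inRow≡d x)
    where
    y-follows-x : ∀ i → inRow A i x ∧ inRow A i y ≡ inRow A i x
    y-follows-x i = ∧-≡ˡ (λ i∋x → inRow-≢miss (λ i≡miss → inRow≡true⇒≢miss i∋x (trans i≡miss (sym same))))

  rowPart-distinctMiss : ∀ {x y} → miss x ≢ miss y → suc (rowPart x y) ≡ d
  rowPart-distinctMiss {x} {y} distinct = +-cancelʳ-≡ d _ _ (begin
    suc (rowPart x y) + d                                    ≡⟨ sym (+-suc (rowPart x y) d) ⟩
    rowPart x y + suc d                                      ≡⟨ count-∧-cover (suc d) (λ i → inRow A i x) (λ i → inRow A i y) cover ⟩
    count (suc d) (λ i → inRow A i x) + count (suc d) (λ i → inRow A i y) ≡⟨ cong₂ _+_ (count-inRow≡d x) (count-inRow≡d y) ⟩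
    d + d                                                    ∎)
    where
    open ≡-Reasoning
    cover : ∀ i → inRow A i x ∨ inRow A i y ≡ true
    cover i = ∨-≡true (λ i∌x → inRow-≢miss (λ i≡miss → distinct (trans (sym (inRow≡false⇒miss i∌x)) i≡miss)))

  colMissing : Fin (suc d) → Fin c → ℕ
  colMissing i j = count v (λ x → inCol A j x ∧ not (inRow A i x))

  rcMeet+colMissing : ∀ i j → rcMeet A i j + colMissing i j ≡ suc d
  rcMeet+colMissing i j = begin
    rcMeet A i j + colMissing i j                            ≡⟨ cong (_+ colMissing i j) (count-cong v (λ x → ∧-comm (inRow A i x) (inCol A j x))) ⟩
    count v (λ x → inCol A j x ∧ inRow A i x) + colMissing i j ≡⟨ sym (count-split v (inCol A j) (inRow A i)) ⟩
    count v (inCol A j)                                      ≡⟨ colSize A bin j ⟩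
    suc d                                                    ∎
    where open ≡-Reasoning

  sumF-rcMeet : ∀ j → sumF (suc d) (λ i → rcMeet A i j) ≡ d * suc d
  sumF-rcMeet j = trans (double-counting (suc d) v (inRow A) (inCol A j) d (λ x _ → count-inRow≡d x))
                        (cong (d *_) (colSize A bin j))

  totRC≡ : totRC A ≡ d * (suc d * c)
  totRC≡ = begin
    sumF (suc d) (λ i → sumF c (rcMeet A i))          ≡⟨ sumF-swap (suc d) c (rcMeet A) ⟩
    sumF c (λ j → sumF (suc d) (λ i → rcMeet A i j))  ≡⟨ sumF-cong c sumF-rcMeet ⟩
    sumF c (λ _ → d * suc d)                          ≡⟨ sumF-const c (d * suc d) ⟩
    c * (d * suc d)                                   ≡⟨ rearrange c d (suc d) ⟩
    d * (suc d * c)                                   ∎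
    where
    open ≡-Reasoning
    rearrange : ∀ a b c → a * (b * c) ≡ b * (c * a)
    rearrange = solve-∀

  SameMissDisjoint AtMostOneCommonColumn AtMostOneCommonSymbol : Set
  SameMissDisjoint      = ∀ x y → x ≢ y → miss x ≡ miss y → colPart x y ≡ 0
  AtMostOneCommonColumn = ∀ x y → x ≢ y → colPart x y ≤ 1
  AtMostOneCommonSymbol = ∀ j j' → j ≢ j' → ccMeet A j j' ≤ 1

  rcMeet≡d⇒SameMissDisjoint : (∀ i j → rcMeet A i j ≡ d) → SameMissDisjoint
  rcMeet≡d⇒SameMissDisjoint rc≡d x y x≢y same = count-false c noCommonColumn
    where
    colMissing≡1 : ∀ j → colMissing (miss x) j ≡ 1
    colMissing≡1 j = +-cancelˡ-≡ d _ 1 (trans (cong (_+ colMissing (miss x) j) (sym (rc≡d (miss x) j)))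
                                              (trans (rcMeet+colMissing (miss x) j) (+-comm 1 d)))
    noCommonColumn : ∀ j → inCol A j x ∧ inCol A j y ≡ false
    noCommonColumn j = ∧-≡false λ j∋x j∋y → contradiction (≤-reflexive (colMissing≡1 j))
      (<⇒≱ (count≥2 v (λ z → inCol A j z ∧ not (inRow A (miss x) z)) x≢y
                    (cong₂ _∧_ j∋x (cong not (inRow-miss x)))
                    (cong₂ _∧_ j∋y (cong not (trans (cong (λ i → inRow A i y) same) (inRow-miss y))))))

  SameMissDisjoint⇒rcMeet≡d : SameMissDisjoint → ∀ i j → rcMeet A i j ≡ d
  SameMissDisjoint⇒rcMeet≡d disjoint i j = sym (sumF-mono-≤-≡⇒≡ (suc d) d≤rcMeet sums i)
    where
    colMissing≤1 : ∀ i → colMissing i j ≤ 1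
    colMissing≤1 i = count≤1 v (λ x → inCol A j x ∧ not (inRow A i x)) unique
      where
      unique : AtMostOne v (λ x → inCol A j x ∧ not (inRow A i x))
      unique x y ex ey = decidable-stable (x ≟ y) λ x≢y →
        contradiction (subst (1 ≤_) (disjoint x y x≢y same) (count≥1 c (λ j → inCol A j x ∧ inCol A j y) {j} (cong₂ _∧_ j∋x j∋y))) λ ()
        where
        j∋x : inCol A j x ≡ true
        j∋x = proj₁ (∧≡true⇒× {inCol A j x} ex)
        j∋y : inCol A j y ≡ true
        j∋y = proj₁ (∧≡true⇒× {inCol A j y} ey)
        same : miss x ≡ miss y
        same = trans (sym (inRow≡false⇒miss (not-injective (proj₂ (∧≡true⇒× {inCol A j x} ex)))))
                     (inRow≡false⇒miss (not-injective (proj₂ (∧≡true⇒× {inCol A j y} ey))))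
    d≤rcMeet : ∀ i → d ≤ rcMeet A i j
    d≤rcMeet i = +-cancelʳ-≤ 1 d (rcMeet A i j)
      (≤-trans (≤-reflexive (trans (+-comm d 1) (sym (rcMeet+colMissing i j)))) (+-monoʳ-≤ (rcMeet A i j) (colMissing≤1 i)))
    sums : sumF (suc d) (λ _ → d) ≡ sumF (suc d) (λ i → rcMeet A i j)
    sums = trans (sumF-const (suc d) d) (trans (*-comm (suc d) d) (sym (sumF-rcMeet j)))

  sumF-ccMeet : ∀ j → sumF c (punctured j (ccMeet A j)) + suc d ≡ d * suc d
  sumF-ccMeet j = trans (cong (sumF c (punctured j (ccMeet A j)) +_) (sym (colSize A bin j)))
    (trans (sumF-punctured-meet c v (λ j x → inCol A j x) j d (λ x _ → count-inCol≡d x)) (cong (d *_) (colSize A bin j)))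

  sumF-colPart : ∀ x → sumF v (punctured x (colPart x)) + d ≡ suc d * d
  sumF-colPart x = trans (cong (sumF v (punctured x (colPart x)) +_) (sym (count-inCol≡d x)))
    (trans (sumF-punctured-meet v c (λ x j → inCol A j x) x (suc d) (λ j _ → colSize A bin j)) (cong (suc d *_) (count-inCol≡d x)))

  ccMeet≤1⇒colPart≤1 : AtMostOneCommonSymbol → AtMostOneCommonColumn
  ccMeet≤1⇒colPart≤1 = meet≤1-transpose c v (λ j x → inCol A j x)

  colPart≤1⇒ccMeet≤1 : AtMostOneCommonColumn → AtMostOneCommonSymbol
  colPart≤1⇒ccMeet≤1 = meet≤1-transpose v c (λ x j → inCol A j x)

  ccMeet≡1-if-c≡d*d : c ≡ d * d → AtMostOneCommonSymbol → ∀ j j' → j ≢ j' → ccMeet A j j' ≡ 1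
  ccMeet≡1-if-c≡d*d c≡d*d oneSymbol j j' j≢j' =
    trans (sym (punctured-≢ (ccMeet A j) j≢j')) (trans (sumF-mono-≤-≡⇒≡ c ≤one sums j') (punctured-≢ (λ _ → 1) j≢j'))
    where
    ≤one : ∀ j' → punctured j (ccMeet A j) j' ≤ punctured j (λ _ → 1) j'
    ≤one = punctured-mono-≤ j (oneSymbol j)
    sums : sumF c (punctured j (ccMeet A j)) ≡ sumF c (punctured j (λ _ → 1))
    sums = +-cancelʳ-≡ (suc d) _ _ (begin
      sumF c (punctured j (ccMeet A j)) + suc d   ≡⟨ sumF-ccMeet j ⟩
      d * suc d                                   ≡⟨ *-suc d d ⟩
      d + d * d                                   ≡⟨ cong (d +_) (sym c≡d*d) ⟩
      d + c                                       ≡⟨ cong (d +_) (sym (trans (sumF-punctured c j (λ _ → 1)) (trans (sumF-const c 1) (*-identityʳ c)))) ⟩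
      d + (sumF c (punctured j (λ _ → 1)) + 1)    ≡⟨ shuffle d _ ⟩
      sumF c (punctured j (λ _ → 1)) + suc d      ∎)
      where
      open ≡-Reasoning
      shuffle : ∀ m n → m + (n + 1) ≡ n + suc m
      shuffle = solve-∀

  colPart≡1-if-c≡d*d : c ≡ d * d → SameMissDisjoint → AtMostOneCommonColumn →
                       ∀ x y → miss x ≢ miss y → colPart x y ≡ 1
  colPart≡1-if-c≡d*d c≡d*d disjoint oneColumn x y distinct =
    trans (sym (punctured-≢ (colPart x) x≢y)) (trans (sumF-mono-≤-≡⇒≡ v ≤inMissRow sums y)
      (trans (punctured-≢ inMissRow x≢y) (cong ind (inRow-≢miss distinct))))
    where
    x≢y : x ≢ y
    x≢y x≡y = distinct (cong miss x≡y)
    inMissRow : Fin v → ℕ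
    inMissRow y = ind (inRow A (miss x) y)
    ≤inMissRow : ∀ y → punctured x (colPart x) y ≤ punctured x inMissRow y
    ≤inMissRow = punctured-mono-≤ x λ y x≢y →
      ≤-ind (λ _ → oneColumn x y x≢y) (λ row∌y → ≤-reflexive (disjoint x y x≢y (inRow≡false⇒miss row∌y)))
    sums : sumF v (punctured x (colPart x)) ≡ sumF v (punctured x inMissRow)
    sums = +-cancelʳ-≡ d _ _ (begin
      sumF v (punctured x (colPart x)) + d              ≡⟨ sumF-colPart x ⟩
      d + d * d                                         ≡⟨ +-comm d (d * d) ⟩
      d * d + d                                         ≡⟨ cong (_+ d) (sym c≡d*d) ⟩
      c + d                                             ≡⟨ cong (_+ d) (sym (rowSize A bin (miss x))) ⟩
      count v (inRow A (miss x)) + d                    ≡⟨ cong (_+ d) (sym (sumF-punctured v x inMissRow)) ⟩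
      sumF v (punctured x inMissRow) + inMissRow x + d  ≡⟨ cong (λ b → sumF v (punctured x inMissRow) + ind b + d) (inRow-miss x) ⟩
      sumF v (punctured x inMissRow) + 0 + d            ≡⟨ cong (_+ d) (+-identityʳ _) ⟩
      sumF v (punctured x inMissRow) + d                ∎)
      where open ≡-Reasoning

  pairCount-sameMiss : ∀ {x y} → x ≢ y → SameMissDisjoint → miss x ≡ miss y → pairCount A x y ≡ d
  pairCount-sameMiss {x} {y} x≢y disjoint same =
    trans (cong₂ _+_ (rowPart-sameMiss same) (disjoint x y x≢y same)) (+-identityʳ d)

  disjoint∧oneColumn⇒pairCount≤d : SameMissDisjoint → AtMostOneCommonColumn → ∀ x y → x ≢ y → pairCount A x y ≤ d
  disjoint∧oneColumn⇒pairCount≤d disjoint oneColumn x y x≢y = [ sameMiss , distinctMiss ]′ (toSum (miss x ≟ miss y))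
    where
    sameMiss : miss x ≡ miss y → pairCount A x y ≤ d
    sameMiss same = ≤-reflexive (pairCount-sameMiss x≢y disjoint same)
    distinctMiss : miss x ≢ miss y → pairCount A x y ≤ d
    distinctMiss distinct = ≤-trans (+-monoʳ-≤ (rowPart x y) (oneColumn x y x≢y))
                                    (≤-reflexive (trans (+-comm (rowPart x y) 1) (rowPart-distinctMiss distinct)))

  d≤1+pairCount : ∀ x y → d ≤ suc (pairCount A x y)
  d≤1+pairCount x y = [ sameMiss , distinctMiss ]′ (toSum (miss x ≟ miss y))
    where
    sameMiss : miss x ≡ miss y → d ≤ suc (pairCount A x y)
    sameMiss same = ≤-trans (≤-reflexive (sym (rowPart-sameMiss same))) (≤-trans (m≤m+n _ _) (n≤1+n _))
    distinctMiss : miss x ≢ miss y → d ≤ suc (pairCount A x y)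
    distinctMiss distinct = ≤-trans (≤-reflexive (sym (rowPart-distinctMiss distinct))) (s≤s (m≤m+n _ _))

  pairCount≤d⇒SameMissDisjoint : (∀ x y → x ≢ y → pairCount A x y ≤ d) → SameMissDisjoint
  pairCount≤d⇒SameMissDisjoint pc≤d x y x≢y same = n≤0⇒n≡0 (+-cancelˡ-≤ d _ 0 (begin
    d + colPart x y           ≡⟨ cong (_+ colPart x y) (sym (rowPart-sameMiss same)) ⟩
    pairCount A x y           ≤⟨ pc≤d x y x≢y ⟩
    d                         ≡⟨ sym (+-identityʳ d) ⟩
    d + 0                     ∎))
    where open ≤-Reasoning

  pairCount≤d⇒colPart≤1 : (∀ x y → x ≢ y → pairCount A x y ≤ d) → AtMostOneCommonColumn
  pairCount≤d⇒colPart≤1 pc≤d x y x≢y = [ sameMiss , distinctMiss ]′ (toSum (miss x ≟ miss y))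
    where
    sameMiss : miss x ≡ miss y → colPart x y ≤ 1
    sameMiss same = ≤-trans (≤-reflexive (pairCount≤d⇒SameMissDisjoint pc≤d x y x≢y same)) z≤n
    distinctMiss : miss x ≢ miss y → colPart x y ≤ 1
    distinctMiss distinct = +-cancelˡ-≤ (rowPart x y) _ 1
      (≤-trans (pc≤d x y x≢y) (≤-reflexive (trans (sym (rowPart-distinctMiss distinct)) (+-comm 1 (rowPart x y)))))

  pairCount≡d-if-c≡d*d : c ≡ d * d → SameMissDisjoint → AtMostOneCommonColumn →
                         ∀ x y → x ≢ y → pairCount A x y ≡ d
  pairCount≡d-if-c≡d*d c≡d*d disjoint oneColumn x y x≢y = [ pairCount-sameMiss x≢y disjoint , distinctMiss ]′ (toSum (miss x ≟ miss y))
    where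
    distinctMiss : miss x ≢ miss y → pairCount A x y ≡ d
    distinctMiss distinct = trans (cong (rowPart x y +_) (colPart≡1-if-c≡d*d c≡d*d disjoint oneColumn x y distinct))
                                  (trans (+-comm (rowPart x y) 1) (rowPart-distinctMiss distinct))

-- s = d + t; the tight case t = 0 is the one in which λ_cc and μ are integers.
module Parameters (d-2 t : ℕ) where

  d-1 d k s c v W : ℕ
  d-1 = suc d-2
  d   = suc d-1
  k   = suc d
  s   = d + t
  c   = d * s
  v   = k * s
  W   = d-1 * k

  μ-num μ-den : ℕ
  μ-num = (c C 2) * k + (k C 2) * c
  μ-den = v C 2

  c≡d*d : t ≡ 0 → c ≡ d * d
  c≡d*d refl = cong (d *_) (+-identityʳ d)

  k*c≡d*v : k * c ≡ d * v
  k*c≡d*v = poly d s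
    where
    poly : ∀ d s → suc d * (d * s) ≡ d * (suc d * s)
    poly = solve-∀

  c∸1≡W+d*t : c ∸ 1 ≡ W + d * t
  c∸1≡W+d*t = poly d-1 t
    where
    poly : ∀ d-1 t → let d = suc d-1; s = d + t in d-1 + t + d-1 * s ≡ d-1 * suc d + d * t
    poly = solve-∀

  twice-μ-num : 2 * μ-num ≡ c * (c ∸ 1) * k + k * d * c
  twice-μ-num = begin
    2 * ((c C 2) * k + (k C 2) * c)           ≡⟨ *-distribˡ-+ 2 ((c C 2) * k) ((k C 2) * c) ⟩
    2 * ((c C 2) * k) + 2 * ((k C 2) * c)     ≡⟨ cong₂ _+_ (sym (*-assoc 2 (c C 2) k)) (sym (*-assoc 2 (k C 2) c)) ⟩
    2 * (c C 2) * k + 2 * (k C 2) * c         ≡⟨ cong₂ (λ a b → a * k + b * c) (2*nC2≡n*[n∸1] c) (2*nC2≡n*[n∸1] k) ⟩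
    c * (c ∸ 1) * k + k * d * c               ∎
    where open ≡-Reasoning

  -- 2 μ-num = c k (c + k − 2) and 2 μ-den = v (v − 1), so
  -- d · 2 μ-den − 2 μ-num = k s d (s − d) and 2 μ-num − (d − 1) · 2 μ-den = k s (s + d² − 1).
  -- The polynomials below use that c ∸ 1 and v ∸ 1 reduce to d-1 + t + d-1 * s and d-1 + t + d * s.
  μ-upper : 2 * μ-num + k * s * d * t ≡ d * (2 * μ-den)
  μ-upper = trans (cong (_+ k * s * d * t) twice-μ-num) (trans (poly d-1 t) (cong (d *_) (sym (2*nC2≡n*[n∸1] v))))
    where
    poly : ∀ d-1 t → let d = suc d-1; k = suc d; s = d + t; c = d * s; v = k * s in
           c * (d-1 + t + d-1 * s) * k + k * d * c + k * s * d * t ≡ d * (v * (d-1 + t + d * s))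
    poly = solve-∀

  μ-lower : d-1 * (2 * μ-den) + k * s * (s + W) ≡ 2 * μ-num
  μ-lower = trans (cong (λ x → d-1 * x + k * s * (s + W)) (2*nC2≡n*[n∸1] v)) (trans (poly d-1 t) (sym twice-μ-num))
    where
    poly : ∀ d-1 t → let d = suc d-1; k = suc d; s = d + t; c = d * s; v = k * s in
           d-1 * (v * (d-1 + t + d * s)) + k * s * (s + d-1 * k) ≡ c * (d-1 + t + d-1 * s) * k + k * d * c
    poly = solve-∀

  0<μ-den : 0 < μ-den
  0<μ-den = *-cancelˡ-< 2 0 μ-den (subst (0 <_) (sym (2*nC2≡n*[n∸1] v)) z<s)

  μ-num≤d*μ-den : μ-num ≤ d * μ-den
  μ-num≤d*μ-den = *-cancelˡ-≤ 2 (begin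
    2 * μ-num                     ≤⟨ m≤m+n (2 * μ-num) (k * s * d * t) ⟩
    2 * μ-num + k * s * d * t     ≡⟨ μ-upper ⟩
    d * (2 * μ-den)               ≡⟨ m*[2*n]≡2*[m*n] d μ-den ⟩
    2 * (d * μ-den)               ∎)
    where open ≤-Reasoning

  μ-num<d*μ-den : 0 < t → μ-num < d * μ-den
  μ-num<d*μ-den 0<t = *-cancelˡ-< 2 μ-num (d * μ-den) (begin-strict
    2 * μ-num                     <⟨ m<m+n (2 * μ-num) (≤-trans 0<t (m≤n*m t (k * s * d))) ⟩
    2 * μ-num + k * s * d * t     ≡⟨ μ-upper ⟩
    d * (2 * μ-den)               ≡⟨ m*[2*n]≡2*[m*n] d μ-den ⟩
    2 * (d * μ-den)               ∎)
    where open ≤-Reasoning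

  μ-num≡d*μ-den : t ≡ 0 → μ-num ≡ d * μ-den
  μ-num≡d*μ-den refl = *-cancelˡ-≡ μ-num (d * μ-den) 2 (begin
    2 * μ-num                     ≡⟨ sym (+-identityʳ (2 * μ-num)) ⟩
    2 * μ-num + 0                 ≡⟨ cong (2 * μ-num +_) (sym (*-zeroʳ (k * s * d))) ⟩
    2 * μ-num + k * s * d * 0     ≡⟨ μ-upper ⟩
    d * (2 * μ-den)               ≡⟨ m*[2*n]≡2*[m*n] d μ-den ⟩
    2 * (d * μ-den)               ∎)
    where open ≡-Reasoning

  d-1*μ-den<μ-num : d-1 * μ-den < μ-num
  d-1*μ-den<μ-num = *-cancelˡ-< 2 (d-1 * μ-den) μ-num (begin-strict
    2 * (d-1 * μ-den)                    ≡⟨ sym (m*[2*n]≡2*[m*n] d-1 μ-den) ⟩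
    d-1 * (2 * μ-den)                    <⟨ m<m+n (d-1 * (2 * μ-den)) z<s ⟩
    d-1 * (2 * μ-den) + k * s * (s + W) ≡⟨ μ-lower ⟩
    2 * μ-num                            ∎)
    where open ≤-Reasoning

  ceilDiv-μ≡d : ceilDiv μ-num μ-den ≡ d
  ceilDiv-μ≡d = ceilDiv-unique d-1*μ-den<μ-num μ-num≤d*μ-den

  floorDiv-μ≡d-1 : 0 < t → floorDiv μ-num μ-den ≡ d-1
  floorDiv-μ≡d-1 0<t = floorDiv-unique (<⇒≤ d-1*μ-den<μ-num) (μ-num<d*μ-den 0<t)

  ceilDiv-c*W≡1 : ceilDiv (c * W) (c * (c ∸ 1)) ≡ 1
  ceilDiv-c*W≡1 = ceilDiv-unique z<s (subst (c * W ≤_) (sym (*-identityˡ _)) (*-monoʳ-≤ c W≤c∸1))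
    where
    W≤c∸1 : W ≤ c ∸ 1
    W≤c∸1 = subst (W ≤_) (sym c∸1≡W+d*t) (m≤m+n W (d * t))

  floorDiv-c*W≡0 : 0 < t → floorDiv (c * W) (c * (c ∸ 1)) ≡ 0
  floorDiv-c*W≡0 0<t = floorDiv-unique z≤n (subst (c * W <_) (sym (*-identityˡ _)) (*-monoʳ-< c W<c∸1))
    where
    W<c∸1 : W < c ∸ 1
    W<c∸1 = subst (W <_) (sym c∸1≡W+d*t) (m<m+n W (≤-trans 0<t (m≤n*m t d)))

  c*W≡1*[c*[c∸1]] : t ≡ 0 → c * W ≡ 1 * (c * (c ∸ 1))
  c*W≡1*[c*[c∸1]] refl = begin
    c * W                  ≡⟨ cong (c *_) (sym (+-identityʳ W)) ⟩
    c * (W + 0)            ≡⟨ cong (λ x → c * (W + x)) (sym (*-zeroʳ d)) ⟩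
    c * (W + d * 0)        ≡⟨ cong (c *_) (sym c∸1≡W+d*t) ⟩
    c * (c ∸ 1)            ≡⟨ sym (*-identityˡ _) ⟩
    1 * (c * (c ∸ 1))      ∎
    where open ≡-Reasoning

  module BinaryEquireplicate (A : Design k c v) (bin : Binary A) (equi : EquiOrNearEqui A) where

    rep≡d : ∀ x → rep A x ≡ d
    rep≡d x = Near-exact⇒ {q = v} z<s k*c≡d*v (equi x)

    open OneMissingRow A bin rep≡d public

    totCC≡ : totCC A ≡ c * W
    totCC≡ = trans (sumF-cong c (λ j → +-cancelʳ-≡ k _ W (trans (sumF-ccMeet j) (+-comm k W)))) (sumF-const c W)

    ceilDiv-totCC≡1 : ceilDiv (totCC A) (c * (c ∸ 1)) ≡ 1
    ceilDiv-totCC≡1 = trans (cong (λ p → ceilDiv p (c * (c ∸ 1))) totCC≡) ceilDiv-c*W≡1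

    floorDiv-totCC≡0 : 0 < t → floorDiv (totCC A) (c * (c ∸ 1)) ≡ 0
    floorDiv-totCC≡0 0<t = trans (cong (λ p → floorDiv p (c * (c ∸ 1))) totCC≡) (floorDiv-c*W≡0 0<t)

  NTA⇒NBG : (A : Design k c v) → NearTripleArray A → NearBalancedGrid A
  NTA⇒NBG A (bin , equi , rcNear , _ , ccNear) = bin , equi , pairNear
    where
    open BinaryEquireplicate A bin equi
    sameMissDisjoint : SameMissDisjoint
    sameMissDisjoint = rcMeet≡d⇒SameMissDisjoint (λ i j → Near-exact⇒ {q = k * c} z<s totRC≡ (rcNear i j))
    oneCommonColumn : AtMostOneCommonColumn
    oneCommonColumn = ccMeet≤1⇒colPart≤1 λ j j' j≢j' →
      subst (ccMeet A j j' ≤_) ceilDiv-totCC≡1 (Near⇒≤ceilDiv {p = totCC A} {c * (c ∸ 1)} (ccNear j j' j≢j'))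
    pairNear : ∀ x y → x ≢ y → Near (pairCount A x y) μ-num μ-den
    pairNear x y x≢y = [ loose , tight ]′ (m≤n⇒m<n∨m≡n (z≤n {t}))
      where
      loose : 0 < t → Near (pairCount A x y) μ-num μ-den
      loose 0<t = Near-between {p = μ-num} {μ-den} (floorDiv-μ≡d-1 0<t) ceilDiv-μ≡d
        (≤-pred (d≤1+pairCount x y)) (disjoint∧oneColumn⇒pairCount≤d sameMissDisjoint oneCommonColumn x y x≢y)
      tight : 0 ≡ t → Near (pairCount A x y) μ-num μ-den
      tight 0≡t = Near-exact⇐ 0<μ-den (μ-num≡d*μ-den (sym 0≡t))
        (pairCount≡d-if-c≡d*d (c≡d*d (sym 0≡t)) sameMissDisjoint oneCommonColumn x y x≢y)

  NBG⇒NTA : (A : Design k c v) → NearBalancedGrid A → NearTripleArray A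
  NBG⇒NTA A (bin , equi , pairNear) = bin , equi , rcNear , rrNear , ccNear
    where
    open BinaryEquireplicate A bin equi
    pairCount≤d : ∀ x y → x ≢ y → pairCount A x y ≤ d
    pairCount≤d x y x≢y = subst (pairCount A x y ≤_) ceilDiv-μ≡d (Near⇒≤ceilDiv {p = μ-num} {μ-den} (pairNear x y x≢y))
    rcNear : ∀ i j → Near (rcMeet A i j) (totRC A) (k * c)
    rcNear i j = Near-exact⇐ z<s totRC≡ (SameMissDisjoint⇒rcMeet≡d (pairCount≤d⇒SameMissDisjoint pairCount≤d) i j)
    rrNear : ∀ i i' → i ≢ i' → Near (rrMeet A i i') (totRR A) (k * d)
    rrNear i i' i≢i' = Near-exact⇐ z<s totRR≡ (rrMeet≡c+c∸v i≢i')
    oneCommonSymbol : AtMostOneCommonSymbol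
    oneCommonSymbol = colPart≤1⇒ccMeet≤1 (pairCount≤d⇒colPart≤1 pairCount≤d)
    ccNear : ∀ j j' → j ≢ j' → Near (ccMeet A j j') (totCC A) (c * (c ∸ 1))
    ccNear j j' j≢j' = [ loose , tight ]′ (m≤n⇒m<n∨m≡n (z≤n {t}))
      where
      loose : 0 < t → Near (ccMeet A j j') (totCC A) (c * (c ∸ 1))
      loose 0<t = Near-between {p = totCC A} {c * (c ∸ 1)} (floorDiv-totCC≡0 0<t) ceilDiv-totCC≡1 z≤n (oneCommonSymbol j j' j≢j')
      tight : 0 ≡ t → Near (ccMeet A j j') (totCC A) (c * (c ∸ 1))
      tight 0≡t = Near-exact⇐ z<s (trans totCC≡ (c*W≡1*[c*[c∸1]] (sym 0≡t)))
        (ccMeet≡1-if-c≡d*d (c≡d*d (sym 0≡t)) oneCommonSymbol j j' j≢j')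

corollary7p3 : (k s : ℕ) → 3 ≤ k → k ∸ 1 ≤ s →
    (A : Design k ((k ∸ 1) * s) (k * s)) →
    (NearTripleArray A → NearBalancedGrid A) × (NearBalancedGrid A → NearTripleArray A)
corollary7p3 (suc (suc (suc d-2))) s (s≤s (s≤s (s≤s z≤n))) d≤s A with m≤n⇒∃[o]m+o≡n d≤s
... | t , refl = NTA⇒NBG A , NBG⇒NTA A
  where open Parameters d-2 t
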